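{- Let $n=p^\alpha$ with $p$ an odd prime and $\alpha$ a positive integer, and suppose $\varphi(n)/2$ is odd. Then every integer $b$ coprime to $n$ is a quadratic residue $\mathrm{mod}^\star\, n$, and $x=b^{(\varphi(n)/2+1)/2}$ satisfies $x^2\equiv b\ (\mathrm{mod}^\star\, n)$.
   Context: For a positive integer $n$ and integers $a,b$ coprime to $n$, write $a\equiv b\ (\mathrm{mod}^\star\, n)$ if $a-b\in n\mathbb{Z}$ or $a+b\in n\mathbb{Z}$. An integer $b$ coprime to $n$ is a quadratic residue $\mathrm{mod}^\star\, n$ if $b\equiv y^2\ (\mathrm{mod}^\star\, n)$ for some integer $y$ coprime to $n$. $\varphi$ is Euler's totient function. -}

module Defs where

open import Data.Nat as ℕ using (ℕ; suc)
open import Data.Nat.Coprimality using (coprime?)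
open import Data.List using (List; length; filter; map; upTo)
open import Data.Integer as ℤ using (ℤ; +_; _-_; _+_; _^_)
open import Data.Integer.Divisibility using (_∣_)
open import Data.Integer.Coprimality using (Coprime)
open import Data.Sum using (_⊎_)
open import Data.Product using (∃; _×_)

φ : ℕ → ℕ
φ n = length (filter (λ k → coprime? k n) (map suc (upTo n)))

infix 4 _≋_[mod⋆_]
_≋_[mod⋆_] : ℤ → ℤ → ℕ → Set
a ≋ b [mod⋆ n ] = ((+ n) ∣ (a - b)) ⊎ ((+ n) ∣ (a + b))

QuadResidue⋆ : ℕ → ℤ → Set
QuadResidue⋆ n b = ∃ λ (y : ℤ) → Coprime y (+ n) × ((b) ≋ (y ^ 2) [mod⋆ n ])

module Submission where

-- Let n = p^α with p an odd prime and let b be coprime to n.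
--  * Euler's theorem  b^φ(n) ≡ 1 (mod n),  proved in the classical way:
--    multiplication by b, reduced modulo n, permutes the reduced residues
--    1 ≤ r ≤ n, gcd(r,n) = 1, so comparing the products of both lists
--    gives  b^φ(n)·∏r ≡ ∏r  and ∏r may be cancelled.
--  * φ(n) is even for n > 2 (Euler's theorem for b = -1 would otherwise
--    give -1 ≡ 1, i.e. n ∣ 2), so  w = b^(φ(n)/2)  satisfies w² ≡ 1.
--  * Modulo an odd prime power, w² ≡ 1 forces w ≡ ±1, i.e. w ≡ 1 (mod⋆ n):
--    p cannot divide both w - 1 and w + 1, as it would divide 2.
--
-- When m = φ(n)/2 is odd, x = b^((m+1)/2) has x² = b^(m+1) = w·b ≡ ±b,
-- which is the statement.

open import Defs
open import Data.Nat as ℕ using (ℕ; _/_; _≥_)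
open import Data.Nat.Primality using (Prime)
open import Data.Nat.Divisibility as ℕD using ()
open import Data.Integer as ℤ using (ℤ; +_; _^_)
open import Data.Integer.Coprimality using (Coprime)
open import Data.Product using (_×_)
open import Relation.Binary.PropositionalEquality using (_≡_)
open import Relation.Nullary using (¬_)

open import Data.Nat using (zero; suc; _<_; NonZero; NonTrivial)
import Data.Nat.Properties as ℕP
import Data.Nat.DivMod as ℕDM
open import Data.Nat.Divisibility using (divides; _∣_; ∣-refl)
import Data.Nat.Coprimality as ℕC
open import Data.Nat.Primality using (prime⇒irreducible; prime⇒nonTrivial)
open import Data.Nat.ListAction using (product)
open import Data.Nat.ListAction.Properties using (product-↭)
open import Data.Integer using (0ℤ; 1ℤ; -1ℤ; _*_; _-_; _+_; -_; ∣_∣; _⊖_)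
import Data.Integer.Properties as ℤP
open import Data.Integer.DivMod using (_%ℕ_; _/ℕ_; a≡a%ℕn+[a/ℕn]*n; n%ℕd<d)
open import Data.Integer.Divisibility.Signed as ℤS using (divides) renaming (_∣_ to _∣ℤ_)
import Data.Integer.Coprimality as ℤC
import Data.Integer.Divisibility as ℤU
open import Data.Integer.Tactic.RingSolver using (solve-∀)
open import Data.List using (List; []; _∷_; _++_; [_]; map; filter; upTo; length)
open import Data.List.Properties using (length-map)
open import Data.List.Membership.Propositional using (_∈_)
open import Data.List.Membership.Propositional.Properties
  using (∈-∃++; ∈-filter⁺; ∈-filter⁻; ∈-map⁺; ∈-map⁻; ∈-upTo⁺; ∈-upTo⁻)
open import Data.List.Relation.Unary.Any using (here; there)
open import Data.List.Relation.Unary.All as All using (All; []; _∷_)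
import Data.List.Relation.Unary.All.Properties as AllP
open import Data.List.Relation.Unary.AllPairs using ([]; _∷_)
open import Data.List.Relation.Unary.Unique.Propositional using (Unique)
import Data.List.Relation.Unary.Unique.Propositional.Properties as UniqueP
open import Data.List.Relation.Binary.Permutation.Propositional
  using (_↭_; ↭-refl; ↭-prep; ↭-sym; ↭-trans)
open import Data.List.Relation.Binary.Permutation.Propositional.Properties
  using (∈-resp-↭; shift; ↭-length)
open import Data.Product using (_,_; proj₁; proj₂)
open import Data.Sum using (_⊎_; inj₁; inj₂)
open import Data.Empty using (⊥-elim)
open import Function using (_∘_)
open import Relation.Binary.PropositionalEquality
  using (refl; sym; trans; cong; subst; subst₂; _≢_; module ≡-Reasoning)
open import Relation.Nullary using (Dec; yes; no)

-- x ≡ y (mod n), i.e. n ∣ x - y; a record so that x, y and n can be inferred.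
infix 4 _≡_[mod_]
record _≡_[mod_] (x y : ℤ) (n : ℕ) : Set where
  constructor congruent
  field n∣x-y : + n ∣ℤ x - y
open _≡_[mod_]

≡mod-refl : ∀ {x n} → x ≡ x [mod n ]
≡mod-refl {x} = congruent (divides 0ℤ (ℤP.+-inverseʳ x))

≡mod-sym : ∀ {x y n} → x ≡ y [mod n ] → y ≡ x [mod n ]
≡mod-sym {x} {y} (congruent d) = congruent (subst (_ ∣ℤ_) (negate x y) (ℤS.∣m⇒∣-m d))
  where
  negate : ∀ x y → - (x - y) ≡ y - x
  negate = solve-∀

≡mod-trans : ∀ {x y z n} → x ≡ y [mod n ] → y ≡ z [mod n ] → x ≡ z [mod n ]
≡mod-trans {x} {y} {z} (congruent d) (congruent e) =
  congruent (subst (_ ∣ℤ_) (telescope x y z) (ℤS.∣m∣n⇒∣m+n d e))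
  where
  telescope : ∀ x y z → (x - y) + (y - z) ≡ x - z
  telescope = solve-∀

≡mod-* : ∀ {x x′ y y′ n} → x ≡ x′ [mod n ] → y ≡ y′ [mod n ] → x * y ≡ x′ * y′ [mod n ]
≡mod-* {x} {x′} {y} {y′} (congruent d) (congruent e) =
  congruent (subst (_ ∣ℤ_) (sym (split x x′ y y′))
                   (ℤS.∣m∣n⇒∣m+n (ℤS.∣n⇒∣m*n x e) (ℤS.∣m⇒∣m*n y′ d)))
  where
  split : ∀ x x′ y y′ → x * y - x′ * y′ ≡ x * (y - y′) + (x - x′) * y′
  split = solve-∀

%ℕ-≡mod : ∀ n .{{_ : NonZero n}} z → + (z %ℕ n) ≡ z [mod n ]
%ℕ-≡mod n z = congruent (divides (- (z /ℕ n)) (begin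
    + (z %ℕ n) - z                            ≡⟨ cong (λ t → + (z %ℕ n) - t) (a≡a%ℕn+[a/ℕn]*n z n) ⟩
    + (z %ℕ n) - (+ (z %ℕ n) + z /ℕ n * + n)  ≡⟨ cancel (+ (z %ℕ n)) (z /ℕ n) (+ n) ⟩
    - (z /ℕ n) * + n                          ∎))
  where
  open ≡-Reasoning
  cancel : ∀ r q n → r - (r + q * n) ≡ - q * n
  cancel = solve-∀

≡mod-cancelˡ : ∀ {z n x y} → Coprime z (+ n) → z * x ≡ z * y [mod n ] → x ≡ y [mod n ]
≡mod-cancelˡ {z} {n} {x} {y} cop (congruent d) = congruent (ℤS.∣ᵤ⇒∣ {+ n}
  (ℤC.coprime-divisor (+ n) z (x - y) (ℤC.sym {z} {+ n} cop)
     (ℤS.∣⇒∣ᵤ (subst (_ ∣ℤ_) (factor z x y) d))))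
  where
  factor : ∀ z x y → z * x - z * y ≡ z * (x - y)
  factor = solve-∀

≡mod-coprime : ∀ {x y n} → x ≡ y [mod n ] → Coprime y (+ n) → Coprime x (+ n)
≡mod-coprime {x} {y} (congruent n∣x-y) cop {d} (d∣x , d∣n) = cop (ℤS.∣⇒∣ᵤ d∣y , d∣n)
  where
  d∣x-y : + d ∣ℤ x - y
  d∣x-y = ℤS.∣-trans (ℤS.∣ᵤ⇒∣ d∣n) n∣x-y
  d∣y : + d ∣ℤ y
  d∣y = subst (_ ∣ℤ_) (recover x y) (ℤS.∣m∣n⇒∣m-n (ℤS.∣ᵤ⇒∣ {+ d} {x} d∣x) d∣x-y)
    where
    recover : ∀ x y → x - (x - y) ≡ y
    recover = solve-∀

≡mod-residue : ∀ {r n s} → r < n → s < n → + r ≡ + s [mod n ] → r ≡ s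
≡mod-residue {r} {n} {s} r<n s<n (congruent d) with ∣ r ⊖ s ∣ in dist
... | zero  = ℤP.+-injective (ℤP.i-j≡0⇒i≡j (+ r) (+ s)
                (trans (ℤP.m-n≡m⊖n r s) (ℤP.∣i∣≡0⇒i≡0 dist)))
... | suc k = ⊥-elim (ℕD.>⇒∤ (distance<n (ℕP.≤-total r s)) n∣distance)
  where
  n∣distance : n ∣ suc k
  n∣distance = subst (n ∣_) (trans (cong ∣_∣ (ℤP.m-n≡m⊖n r s)) dist) (ℤS.∣⇒∣ᵤ d)
  distance<n : r ℕ.≤ s ⊎ s ℕ.≤ r → suc k < n
  distance<n (inj₁ r≤s) = subst (_< n) (trans (sym (ℤP.∣⊖∣-≤ r≤s)) dist)
                            (ℕP.≤-<-trans (ℕP.m∸n≤m s r) s<n)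
  distance<n (inj₂ s≤r) = subst (_< n)
                            (trans (sym (ℤP.∣⊖∣-≤ s≤r)) (trans (ℤP.∣m⊖n∣≡∣n⊖m∣ s r) dist))
                            (ℕP.≤-<-trans (ℕP.m∸n≤m r s) r<n)

coprime-* : ∀ {a n c} → ℕC.Coprime a n → ℕC.Coprime c n → ℕC.Coprime (a ℕ.* c) n
coprime-* {a} {n} {c} a⊥n c⊥n {d} (d∣ac , d∣n) = c⊥n (ℕC.coprime-divisor d⊥a d∣ac , d∣n)
  where
  d⊥a : ℕC.Coprime d a
  d⊥a (e∣d , e∣a) = a⊥n (e∣a , ℕD.∣-trans e∣d d∣n)

coprimeℤ-* : ∀ {x z y} → Coprime x z → Coprime y z → Coprime (x * y) z
coprimeℤ-* {x} {z} {y} x⊥z y⊥z =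
  subst (λ k → ℕC.Coprime k ∣ z ∣) (sym (ℤP.abs-* x y)) (coprime-* x⊥z y⊥z)

coprimeℤ-^ : ∀ {x z} k → Coprime x z → Coprime (x ^ k) z
coprimeℤ-^ {z = z} zero    _   = ℕC.1-coprimeTo ∣ z ∣
coprimeℤ-^ {x} {z} (suc k) x⊥z = coprimeℤ-* {x} {z} {x ^ k} x⊥z (coprimeℤ-^ {x} {z} k x⊥z)

primePower-coprime : ∀ {p m} α → Prime p → ¬ (p ∣ m) → ℕC.Coprime (p ℕ.^ α) m
primePower-coprime {_} {m} zero    _      _   = ℕC.1-coprimeTo m
primePower-coprime {p} {m} (suc α) pPrime p∤m =
  coprime-* p⊥m (primePower-coprime α pPrime p∤m)
  where
  p⊥m : ℕC.Coprime p m
  p⊥m {d} (d∣p , d∣m) with prime⇒irreducible pPrime d∣p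
  ... | inj₁ d≡1  = d≡1
  ... | inj₂ refl = ⊥-elim (p∤m d∣m)

module _ {A : Set} where

  unique-⊆-length⇒↭ : {xs ys : List A} → Unique xs → All (_∈ ys) xs →
                      length xs ≡ length ys → xs ↭ ys
  unique-⊆-length⇒↭ {[]}     {[]}    _              _              _   = ↭-refl
  unique-⊆-length⇒↭ {[]}     {_ ∷ _} _              _              ()
  unique-⊆-length⇒↭ {x ∷ xs} {ys}    (x∉xs ∷ xsUniq) (x∈ys ∷ xs⊆ys) len with ∈-∃++ x∈ys
  ... | us , vs , refl =
    ↭-trans (↭-prep x (unique-⊆-length⇒↭ xsUniq xs⊆us++vs shorter)) (↭-sym (shift x us vs))
    where
    xs⊆us++vs : All (_∈ us ++ vs) xs
    xs⊆us++vs = All.zipWith (λ (y∈ys , x≢y) → dropX y∈ys x≢y) (xs⊆ys , x∉xs)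
      where
      dropX : ∀ {y} → y ∈ us ++ [ x ] ++ vs → x ≢ y → y ∈ us ++ vs
      dropX y∈ x≢y with ∈-resp-↭ (shift x us vs) y∈
      ... | here y≡x  = ⊥-elim (x≢y (sym y≡x))
      ... | there y∈′ = y∈′
    shorter : length xs ≡ length (us ++ vs)
    shorter = ℕP.suc-injective (trans len (↭-length (shift x us vs)))

  unique-map⁺ : {B : Set} (f : A → B) {xs : List A} →
                (∀ {x y} → x ∈ xs → y ∈ xs → f x ≡ f y → x ≡ y) →
                Unique xs → Unique (map f xs)
  unique-map⁺ f {[]}     _   []              = []
  unique-map⁺ f {x ∷ xs} inj (x∉xs ∷ xsUniq) =
    AllP.map⁺ (All.tabulate (λ y∈xs fx≡fy →
      All.lookup x∉xs y∈xs (inj (here refl) (there y∈xs) fx≡fy)))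
    ∷ unique-map⁺ f (λ x∈ y∈ → inj (there x∈) (there y∈)) xsUniq

reducedResidues : ℕ → List ℕ
reducedResidues n = filter (λ k → ℕC.coprime? k n) (map suc (upTo n))

reducedResidues-unique : ∀ n → Unique (reducedResidues n)
reducedResidues-unique n = UniqueP.filter⁺ (λ k → ℕC.coprime? k n)
  (UniqueP.map⁺ ℕP.suc-injective (UniqueP.upTo⁺ n))

module _ {n : ℕ} {{_ : NonTrivial n}} where

  -- For n > 1 the reduced residues are exactly the r < n coprime to n
  -- (0 is never coprime to n, and n is not coprime to itself).
  ∈-reducedResidues⁺ : ∀ {r} → r < n → ℕC.Coprime r n → r ∈ reducedResidues n
  ∈-reducedResidues⁺ {zero}  _   0⊥n = ⊥-elim (ℕC.¬0-coprimeTo-2+ 0⊥n)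
  ∈-reducedResidues⁺ {suc k} r<n r⊥n =
    ∈-filter⁺ (λ k → ℕC.coprime? k n) (∈-map⁺ suc (∈-upTo⁺ (ℕP.<-trans (ℕP.n<1+n k) r<n))) r⊥n

  ∈-reducedResidues⁻ : ∀ {r} → r ∈ reducedResidues n → r < n × ℕC.Coprime r n
  ∈-reducedResidues⁻ r∈ with ∈-filter⁻ (λ k → ℕC.coprime? k n) {xs = map suc (upTo n)} r∈
  ... | r∈range , r⊥n with ∈-map⁻ suc r∈range
  ... | k , k∈upTo , refl = ℕP.≤∧≢⇒< (∈-upTo⁻ k∈upTo) r≢n , r⊥n
    where
    r≢n : suc k ≢ n
    r≢n refl = ℕ.nonTrivial⇒≢1 (r⊥n (∣-refl , ∣-refl))

module Euler (n : ℕ) {{_ : NonTrivial n}} (b : ℤ) (b⊥n : Coprime b (+ n)) where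

  instance
    n≢0 : NonZero n
    n≢0 = ℕ.nonTrivial⇒nonZero n

  mulMod : ℕ → ℕ
  mulMod r = (b * + r) %ℕ n

  mulMod-≡ : ∀ r → + mulMod r ≡ b * + r [mod n ]
  mulMod-≡ r = %ℕ-≡mod n (b * + r)

  mulMod-closed : ∀ {r} → r ∈ reducedResidues n → mulMod r ∈ reducedResidues n
  mulMod-closed {r} r∈ = ∈-reducedResidues⁺ (n%ℕd<d (b * + r) n)
    (≡mod-coprime (mulMod-≡ r) (coprimeℤ-* {b} {+ n} {+ r} b⊥n (proj₂ (∈-reducedResidues⁻ r∈))))

  mulMod-injective : ∀ {r s} → r ∈ reducedResidues n → s ∈ reducedResidues n →
                     mulMod r ≡ mulMod s → r ≡ s
  mulMod-injective {r} {s} r∈ s∈ eq =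
    ≡mod-residue (proj₁ (∈-reducedResidues⁻ r∈)) (proj₁ (∈-reducedResidues⁻ s∈))
      (≡mod-cancelˡ {b} b⊥n (≡mod-trans (≡mod-sym (mulMod-≡ r))
        (subst (λ k → + k ≡ b * + s [mod n ]) (sym eq) (mulMod-≡ s))))

  mulMod-permutes : map mulMod (reducedResidues n) ↭ reducedResidues n
  mulMod-permutes = unique-⊆-length⇒↭
    (unique-map⁺ mulMod mulMod-injective (reducedResidues-unique n))
    (AllP.map⁺ (All.tabulate mulMod-closed))
    (length-map mulMod (reducedResidues n))

  product-mulMod : ∀ rs → + product (map mulMod rs) ≡ b ^ length rs * + product rs [mod n ]
  product-mulMod []       = ≡mod-refl
  product-mulMod (r ∷ rs) = subst₂ (_≡_[mod n ])
    (sym (ℤP.pos-* (mulMod r) (product (map mulMod rs))))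
    (trans (regroup b (+ r) (b ^ length rs) (+ product rs))
           (cong (b ^ suc (length rs) *_) (sym (ℤP.pos-* r (product rs)))))
    (≡mod-* (mulMod-≡ r) (product-mulMod rs))
    where
    regroup : ∀ b r c q → b * r * (c * q) ≡ b * c * (r * q)
    regroup = solve-∀

  -- The product of the reduced residues is coprime to n, so it cancels.
  euler : b ^ φ n ≡ 1ℤ [mod n ]
  euler = ≡mod-sym (≡mod-cancelˡ {P} P⊥n
            (subst₂ (_≡_[mod n ]) (sym (ℤP.*-identityʳ P)) (ℤP.*-comm _ P) P≡b^φP))
    where
    P : ℤ
    P = + product (reducedResidues n)
    P≡b^φP : P ≡ b ^ φ n * P [mod n ]
    P≡b^φP = subst (λ k → + k ≡ b ^ φ n * P [mod n ]) (product-↭ mulMod-permutes)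
               (product-mulMod (reducedResidues n))
    P⊥n : Coprime P (+ n)
    P⊥n = productCoprime (reducedResidues n) (All.tabulate (proj₂ ∘ ∈-reducedResidues⁻))
      where
      productCoprime : ∀ rs → All (λ r → ℕC.Coprime r n) rs → ℕC.Coprime (product rs) n
      productCoprime []       []           = ℕC.1-coprimeTo n
      productCoprime (r ∷ rs) (r⊥n ∷ rs⊥n) = coprime-* r⊥n (productCoprime rs rs⊥n)

even-or-odd : ∀ m → (2 ∣ m) ⊎ (2 ∣ suc m)
even-or-odd zero    = inj₁ (divides 0 refl)
even-or-odd (suc m) with even-or-odd m
... | inj₁ 2∣m   = inj₂ (ℕD.∣m∣n⇒∣m+n ∣-refl 2∣m)
... | inj₂ 2∣1+m = inj₁ 2∣1+m

odd⇒even-suc : ∀ {m} → ¬ (2 ∣ m) → 2 ∣ suc m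
odd⇒even-suc {m} 2∤m with even-or-odd m
... | inj₁ 2∣m   = ⊥-elim (2∤m 2∣m)
... | inj₂ 2∣1+m = 2∣1+m

-1^even : ∀ q → -1ℤ ^ (q ℕ.* 2) ≡ 1ℤ
-1^even q = begin
  -1ℤ ^ (q ℕ.* 2)  ≡⟨ cong (-1ℤ ^_) (ℕP.*-comm q 2) ⟩
  -1ℤ ^ (2 ℕ.* q)  ≡⟨ sym (ℤP.^-*-assoc -1ℤ 2 q) ⟩
  1ℤ ^ q           ≡⟨ ℤP.^-zeroˡ q ⟩
  1ℤ               ∎
  where open ≡-Reasoning

-- φ n is even for n > 2: otherwise Euler's theorem for b = -1 would give
-- -1 ≡ (-1)^(φ n + 1) = 1 (mod n), i.e. n ∣ 2.
φ-even : ∀ n → 2 < n → 2 ∣ φ n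
φ-even n 2<n with even-or-odd (φ n)
... | inj₁ 2∣φ                = 2∣φ
... | inj₂ (divides q 1+φ≡2q) = ⊥-elim (ℕD.>⇒∤ 2<n (ℤS.∣⇒∣ᵤ (n∣x-y 1≡-1)))
  where
  instance
    n-nonTrivial : NonTrivial n
    n-nonTrivial = ℕ.n>1⇒nonTrivial (ℕP.<-trans (ℕP.n<1+n 1) 2<n)
  1≡-1 : 1ℤ ≡ -1ℤ [mod n ]
  1≡-1 = subst (λ t → t ≡ -1ℤ [mod n ]) (trans (cong (-1ℤ ^_) 1+φ≡2q) (-1^even q))
           (≡mod-* (≡mod-refl { -1ℤ}) (Euler.euler n -1ℤ (ℕC.1-coprimeTo n)))

oddPrime>2 : ∀ {p} → Prime p → ¬ (2 ∣ p) → 2 < p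
oddPrime>2 {p} pPrime 2∤p = ℕP.≤∧≢⇒< (ℕ.nonTrivial⇒n>1 p {{prime⇒nonTrivial pPrime}})
                                     (λ 2≡p → 2∤p (subst (2 ∣_) 2≡p ∣-refl))

primePower-divides-factor : ∀ {p} α x y → Prime p → ¬ (p ∣ ∣ x ∣) →
                            + (p ℕ.^ α) ∣ℤ x * y → + (p ℕ.^ α) ℤU.∣ y
primePower-divides-factor α x y pPrime p∤x d =
  ℤC.coprime-divisor (+ _) x y (primePower-coprime α pPrime p∤x) (ℤS.∣⇒∣ᵤ d)

-- Modulo a power of an odd prime, w² ≡ 1 forces w ≡ ±1: p^α divides
-- (w - 1)(w + 1), and p divides at most one factor since it cannot divide 2.
squareRoot-of-one : ∀ {p} α w → Prime p → ¬ (2 ∣ p) →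
                    w ^ 2 ≡ 1ℤ [mod p ℕ.^ α ] → w ≋ 1ℤ [mod⋆ p ℕ.^ α ]
squareRoot-of-one {p} α w pPrime 2∤p (congruent d) = split (p ℕD.∣? ∣ w + 1ℤ ∣)
  where
  differenceOfSquares : ∀ w → w * (w * 1ℤ) - 1ℤ ≡ (w - 1ℤ) * (w + 1ℤ)
  differenceOfSquares = solve-∀
  factored : + (p ℕ.^ α) ∣ℤ (w - 1ℤ) * (w + 1ℤ)
  factored = subst (_ ∣ℤ_) (differenceOfSquares w) d

  gap : ∀ w → (w + 1ℤ) - (w - 1ℤ) ≡ + 2
  gap = solve-∀
  notBoth : p ∣ ∣ w + 1ℤ ∣ → ¬ (p ∣ ∣ w - 1ℤ ∣)
  notBoth p∣w+1 p∣w-1 = ℕD.>⇒∤ (oddPrime>2 pPrime 2∤p) (ℤS.∣⇒∣ᵤ (subst (_ ∣ℤ_) (gap w)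
    (ℤS.∣m∣n⇒∣m-n (ℤS.∣ᵤ⇒∣ {+ p} {w + 1ℤ} p∣w+1) (ℤS.∣ᵤ⇒∣ {+ p} {w - 1ℤ} p∣w-1))))

  split : Dec (p ∣ ∣ w + 1ℤ ∣) → w ≋ 1ℤ [mod⋆ p ℕ.^ α ]
  split (yes p∣w+1) = inj₂ (primePower-divides-factor α (w - 1ℤ) (w + 1ℤ) pPrime
                        (notBoth p∣w+1) factored)
  split (no p∤w+1)  = inj₁ (primePower-divides-factor α (w + 1ℤ) (w - 1ℤ) pPrime p∤w+1
                        (subst (_ ∣ℤ_) (ℤP.*-comm (w - 1ℤ) (w + 1ℤ)) factored))

∣-*ʳ : ∀ {n u v} z → + n ℤU.∣ u → u * z ≡ v → + n ℤU.∣ v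
∣-*ʳ {n} {u} z d eq = ℤS.∣⇒∣ᵤ (subst (+ n ∣ℤ_) eq (ℤS.∣m⇒∣m*n z (ℤS.∣ᵤ⇒∣ {+ n} {u} d)))

≋-sym : ∀ {x y n} → x ≋ y [mod⋆ n ] → y ≋ x [mod⋆ n ]
≋-sym {x} {y} {n} (inj₁ n∣x-y) =
  inj₁ (ℤS.∣⇒∣ᵤ (subst (+ n ∣ℤ_) (negate x y) (ℤS.∣m⇒∣-m (ℤS.∣ᵤ⇒∣ {+ n} {x - y} n∣x-y))))
  where
  negate : ∀ x y → - (x - y) ≡ y - x
  negate = solve-∀
≋-sym {x} {y} {n} (inj₂ n∣x+y) = inj₂ (subst (+ n ℤU.∣_) (ℤP.+-comm x y) n∣x+y)

≋-*ʳ : ∀ {x y n} z → x ≋ y [mod⋆ n ] → x * z ≋ y * z [mod⋆ n ]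
≋-*ʳ {x} {y} {n} z (inj₁ n∣x-y) = inj₁ (∣-*ʳ {n} {x - y} z n∣x-y (distrib x y z))
  where
  distrib : ∀ x y z → (x - y) * z ≡ x * z - y * z
  distrib = solve-∀
≋-*ʳ {x} {y} {n} z (inj₂ n∣x+y) = inj₂ (∣-*ʳ {n} {x + y} z n∣x+y (ℤP.*-distribʳ-+ z x y))

mainTheorem5 : (p α n : ℕ) → Prime p → ¬ (2 ℕD.∣ p) → α ≥ 1 → n ≡ p ℕ.^ α →
  ¬ (2 ℕD.∣ (φ n / 2)) →
  (b : ℤ) → Coprime b (+ n) →
  QuadResidue⋆ n b × (((b ^ ((φ n / 2 ℕ.+ 1) / 2)) ^ 2) ≋ b [mod⋆ n ])
mainTheorem5 p α .(p ℕ.^ α) pPrime 2∤p α≥1 refl m-odd b b⊥n =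
  (x , coprimeℤ-^ {b} {+ n} e b⊥n , ≋-sym {x ^ 2} {b} x²≋b) , x²≋b
  where
  n m e : ℕ
  n = p ℕ.^ α
  m = φ n / 2
  e = (m ℕ.+ 1) / 2
  w x : ℤ
  w = b ^ m
  x = b ^ e

  2<n : 2 < n
  2<n = ℕP.<-≤-trans (oddPrime>2 pPrime 2∤p) p≤n
    where
    instance
      p≢0 : NonZero p
      p≢0 = ℕ.nonTrivial⇒nonZero p {{prime⇒nonTrivial pPrime}}
    p≤n : p ℕ.≤ n
    p≤n = subst (ℕ._≤ n) (ℕP.^-identityʳ p) (ℕP.^-monoʳ-≤ p α≥1)

  instance
    n-nonTrivial : NonTrivial n
    n-nonTrivial = ℕ.n>1⇒nonTrivial (ℕP.<-trans (ℕP.n<1+n 1) 2<n)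

  w²≡1 : w ^ 2 ≡ 1ℤ [mod n ]
  w²≡1 = subst (λ t → t ≡ 1ℤ [mod n ])
           (trans (cong (b ^_) (sym (ℕDM.m/n*n≡m (φ-even n 2<n)))) (sym (ℤP.^-*-assoc b m 2)))
           (Euler.euler n b b⊥n)

  2∣m+1 : 2 ∣ m ℕ.+ 1
  2∣m+1 = subst (2 ∣_) (ℕP.+-comm 1 m) (odd⇒even-suc m-odd)
  x²≡wb : x ^ 2 ≡ w * b
  x²≡wb = begin
    x ^ 2            ≡⟨ ℤP.^-*-assoc b e 2 ⟩
    b ^ (e ℕ.* 2)    ≡⟨ cong (b ^_) (ℕDM.m/n*n≡m 2∣m+1) ⟩
    b ^ (m ℕ.+ 1)    ≡⟨ ℤP.^-distribˡ-+-* b m 1 ⟩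
    w * b ^ 1        ≡⟨ cong (w *_) (ℤP.^-identityʳ b) ⟩
    w * b            ∎
    where open ≡-Reasoning

  x²≋b : x ^ 2 ≋ b [mod⋆ n ]
  x²≋b = subst₂ (_≋_[mod⋆ n ]) (sym x²≡wb) (ℤP.*-identityˡ b)
           (≋-*ʳ {w} {1ℤ} {n} b (squareRoot-of-one α w pPrime 2∤p w²≡1))
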